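{- Let $k\ge 1$ be an integer and $G$ a simple graph, and let $\overrightarrow{G}^{(k)}$ be any oriented graph obtained from $G$ by the construction described in the context. Then $G$ is $(2k+1)$-colorable if and only if $\overrightarrow{G}^{(k)}$ admits a pushable homomorphism to the directed cycle $\overrightarrow{C}_{2k+1}$.
   Context: Construction: given a simple graph $G$ and $k\ge1$, $\overrightarrow{G}^{(k)}$ has vertex set containing $V(G)$, and each edge $uv$ of $G$ is replaced by two internally disjoint oriented paths $\overrightarrow{P}$ and $\overrightarrow{P'}$ from $u$ to $v$, each of length $4k$ and with new internal vertices, such that, traversing from $u$ to $v$, the number of forward arcs (arcs oriented in the direction of traversal) is even in $\overrightarrow{P}$ and odd in $\overrightarrow{P'}$. The directed cycle $\overrightarrow{C}_{2k+1}$ has vertices $0,1,\dots,2k$ and arcs $i\to i+1 \pmod{2k+1}$. To push a vertex means to reverse all arcs incident to it; pushing a set pushes each vertex once; a pushable homomorphism of $\overrightarrow{G}$ to $\overrightarrow{H}$ is a vertex map which is an arc-preserving map from some oriented graph obtained from $\overrightarrow{G}$ by pushing a vertex set to $\overrightarrow{H}$. -}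

module Defs where

open import Data.Nat using (ℕ; zero; suc; _+_; _*_; pred; _%_)
open import Data.Fin using (Fin; zero; suc; inject₁; toℕ) renaming (_<_ to _<ᶠ_)
open import Data.Bool using (Bool; true; false; if_then_else_)
open import Data.Maybe using (Maybe; just; nothing; maybe)
import Data.Maybe as Maybe
open import Data.Product using (Σ; _×_; _,_; ∃; ∃-syntax)
import Data.Product
open import Data.Sum using (_⊎_; inj₁; inj₂)
open import Relation.Binary.PropositionalEquality using (_≡_; _≢_)

record Digraph : Set₁ where
  field
    V   : Set
    Arc : V → V → Set
open Digraph public

-- An arc x → y is reversed iff exactly one of its
-- endpoints is pushed (pushing a vertex reverses every incident arc).
PushedArc : (D : Digraph) → (V D → Bool) → V D → V D → Set
PushedArc D S x y = (Arc D x y × S x ≡ S y) ⊎ (Arc D y x × S x ≢ S y)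

Pushed : (D : Digraph) → (V D → Bool) → Digraph
Pushed D S = record { V = V D ; Arc = PushedArc D S }

IsHom : (D H : Digraph) → (V D → V H) → Set
IsHom D H f = ∀ x y → Arc D x y → Arc H (f x) (f y)

PushableHom : Digraph → Digraph → Set
PushableHom D H = Σ (V D → Bool) λ S → Σ (V D → V H) λ f → IsHom (Pushed D S) H f

DirCycle : ℕ → Digraph
DirCycle k = record
  { V   = Fin (suc (2 * k))
  ; Arc = λ i j → toℕ j ≡ (suc (toℕ i)) % (suc (2 * k)) }

record SimpleGraph (n : ℕ) : Set where
  field
    adj   : Fin n → Fin n → Bool
    sym   : ∀ u v → adj u v ≡ adj v u
    irref : ∀ u → adj u u ≡ false
open SimpleGraph public

Colorable : ∀ {n} → SimpleGraph n → ℕ → Set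
Colorable {n} G c =
  Σ (Fin n → Fin c) λ col → ∀ (u v : Fin n) → adj G u v ≡ true → col u ≢ col v

-- edges of G, each unordered edge {u,v} listed once as (u , v) with u < v
Edge : ∀ {n} → SimpleGraph n → Set
Edge {n} G = Σ (Fin n) λ u → Σ (Fin n) λ v → u <ᶠ v × adj G u v ≡ true

forwards : ∀ {l} → (Fin l → Bool) → ℕ
forwards {zero}  o = 0
forwards {suc l} o = (if o zero then 1 else 0) + forwards (λ i → o (suc i))

-- number of internal vertices of each path; the path length is
-- suc (internal k), which equals 4k for k ≥ 1
internal : ℕ → ℕ
internal k = pred (4 * k)

-- the data of one instance of the construction: for every edge e and
-- each of its two paths p ∈ {0 = P, 1 = P'}, the orientation of the
-- 4k arcs traversed from u to v (true = forward)
record Construction {n} (G : SimpleGraph n) (k : ℕ) : Set where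
  field
    orient : Edge G → Fin 2 → Fin (suc (internal k)) → Bool
    evenP  : ∀ e → forwards (orient e zero) % 2 ≡ 0
    oddP   : ∀ e → forwards (orient e (suc zero)) % 2 ≡ 1
open Construction public

CVert : ∀ {n} → SimpleGraph n → ℕ → Set
CVert {n} G k = Fin n ⊎ (Edge G × Fin 2 × Fin (internal k))

-- position i of a path with m internal vertices, as an internal index
-- (nothing for the last position)
inner : ∀ m → Fin (suc m) → Maybe (Fin m)
inner zero    zero    = nothing
inner (suc m) zero    = just zero
inner (suc m) (suc i) = Maybe.map suc (inner m i)

pos : ∀ {n} {G : SimpleGraph n} {k} → Edge G → Fin 2 →
      Fin (suc (suc (internal k))) → CVert G k
pos (u , v , _) p zero = inj₁ u
pos {G = G} {k = k} e p (suc i) = maybe (λ j → inj₂ (e , p , j)) (inj₁ (Data.Product.proj₁ (Data.Product.proj₂ e))) (inner (internal k) i)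

CArc : ∀ {n} {G : SimpleGraph n} {k} → Construction G k →
       CVert G k → CVert G k → Set
CArc {G = G} {k} C x y =
  Σ (Edge G) λ e → Σ (Fin 2) λ p → Σ (Fin (suc (internal k))) λ j →
    (orient C e p j ≡ true  × pos {G = G} {k = k} e p (inject₁ j) ≡ x × pos {G = G} {k = k} e p (suc j) ≡ y)
  ⊎ (orient C e p j ≡ false × pos {G = G} {k = k} e p (suc j) ≡ x × pos {G = G} {k = k} e p (inject₁ j) ≡ y)

Oriented : ∀ {n} {G : SimpleGraph n} {k} → Construction G k → Digraph
Oriented {G = G} {k} C = record { V = CVert G k ; Arc = CArc C }

-- In a pushable homomorphism to the directed (2k+1)-cycle every arc becomes a step ±1
-- around the cycle, and the direction of the j-th arc of a path is its orientation
-- xor the push labels of its two ends. If both ends of an edge had the same color, each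
-- of its two paths would be a closed walk of length 4k, hence with exactly 2k forward
-- steps; telescoping the push labels then forces the numbers of forward arcs of both
-- paths to have the parity of S(u) + S(v), although one is even and the other odd.
-- Conversely, given a proper coloring, color each path by F forward steps followed by
-- 4k − F backward ones, where F has the parity of its forward arcs and the walk ends at
-- the color of v (possible since 2 is invertible modulo 2k+1 and the colors differ),
-- and push the internal vertices so that the pushed orientation follows this walk.

module Submission where

open import Defs hiding (sym)
open import Data.Nat using (ℕ; _≤_; suc; _*_)
open import Function.Bundles using (_⇔_; mk⇔; Equivalence)

open import Algebra.Bundles using (CommutativeRing)
open import Data.Bool using (Bool; true; false; not; _xor_; if_then_else_)
open import Data.Bool.Properties
  using (not-distribˡ-xor; xor-assoc; xor-comm; xor-same; xor-identityʳ; not-involutive; ¬-not;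
         xor-∧-commutativeRing)
  renaming (_≟_ to _≟ᵇ_)
open import Data.Empty using (⊥-elim)
open import Data.Fin using (Fin; zero; suc; inject₁; fromℕ; fromℕ<; toℕ)
open import Data.Fin.Properties using (toℕ<n; toℕ-fromℕ<; toℕ-injective) renaming (<-cmp to <-cmpᶠ)
open import Data.Maybe using (just; nothing)
open import Data.Nat using (zero; _+_; _<_; _∸_; _%_; _/_; _<ᵇ_; z≤n; s≤s; NonZero)
open import Data.Nat.DivMod
  using (m≡m%n+[m/n]*n; %-congˡ; %-distribˡ-+; m%n%n≡m%n; [m+n]%n≡m%n; [m+kn]%n≡m%n; m%n<n; m<n⇒m%n≡m)
open import Data.Nat.Divisibility using (_∣_; divides; ∣m+n∣m⇒∣n; n∣m*n; ∣n⇒∣m*n)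
open import Data.Nat.Properties
  using (module ≤-Reasoning; +-assoc; +-comm; +-suc; +-identityʳ; +-cancelˡ-≡; +-monoˡ-≤; *-monoˡ-≤;
         ≤-pred; ≤-trans; ≤-reflexive; <⇒≱; ≤∧≢⇒<; m≤m+n; m≤n+m; m+[n∸m]≡n; suc-injective)
open import Data.Nat.Tactic.RingSolver using (solve-∀)
open import Data.Product using (Σ; _×_; _,_; proj₁; proj₂)
open import Data.Sum using (inj₁; inj₂)
open import Function using (_∘_)
open import Relation.Binary.Definitions using (tri<; tri≈; tri>)
open import Relation.Binary.PropositionalEquality
open import Relation.Nullary using (yes; no)

open import Algebra.Properties.CommutativeSemigroup
  (CommutativeRing.+-commutativeSemigroup xor-∧-commutativeRing) using (interchange)

odd : ℕ → Bool
odd zero    = false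
odd (suc n) = not (odd n)

bit : Bool → ℕ
bit b = if b then 1 else 0

odd-+ : ∀ m n → odd (m + n) ≡ odd m xor odd n
odd-+ zero    n = refl
odd-+ (suc m) n = trans (cong not (odd-+ m n)) (not-distribˡ-xor (odd m) (odd n))

odd-bit+ : ∀ b n → odd (bit b + n) ≡ b xor odd n
odd-bit+ false n = refl
odd-bit+ true  n = refl

odd-2* : ∀ n → odd (2 * n) ≡ false
odd-2* n rewrite +-identityʳ n = trans (odd-+ n n) (xor-same (odd n))

n%2≡bit[odd] : ∀ n → n % 2 ≡ bit (odd n)
n%2≡bit[odd] 0 = refl
n%2≡bit[odd] 1 = refl
n%2≡bit[odd] (suc (suc n)) = begin
  (2 + n) % 2        ≡⟨ %-congˡ (+-comm 2 n) ⟩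
  (n + 2) % 2        ≡⟨ [m+n]%n≡m%n n 2 ⟩
  n % 2              ≡⟨ n%2≡bit[odd] n ⟩
  bit (odd n)        ≡⟨ cong bit (sym (not-involutive (odd n))) ⟩
  bit (not (not (odd n))) ∎
  where open ≡-Reasoning

bit-injective : ∀ {a b} → bit a ≡ bit b → a ≡ b
bit-injective {false} {false} _ = refl
bit-injective {true}  {true}  _ = refl
bit-injective {false} {true}  ()
bit-injective {true}  {false} ()

odd-even : ∀ n → n % 2 ≡ 0 → odd n ≡ false
odd-even n n%2≡0 = bit-injective (trans (sym (n%2≡bit[odd] n)) n%2≡0)

odd-odd : ∀ n → n % 2 ≡ 1 → odd n ≡ true
odd-odd n n%2≡1 = bit-injective (trans (sym (n%2≡bit[odd] n)) n%2≡1)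

xor-cancelˡ : ∀ a b → a xor (a xor b) ≡ b
xor-cancelˡ a b = trans (sym (xor-assoc a a b)) (cong (_xor b) (xor-same a))

xor≡false⇒≡ : ∀ {a b} → a xor b ≡ false → a ≡ b
xor≡false⇒≡ {false} {false} _ = refl
xor≡false⇒≡ {true}  {true}  _ = refl

xor≡true⇒≢ : ∀ {a b} → a xor b ≡ true → a ≢ b
xor≡true⇒≢ {false} {true}  _ ()
xor≡true⇒≢ {true}  {false} _ ()

≡⇒xor≡false : ∀ {a b} → a ≡ b → a xor b ≡ false
≡⇒xor≡false {a} refl = xor-same a

≢⇒xor≡true : ∀ {a b} → a ≢ b → a xor b ≡ true
≢⇒xor≡true {false} {false} a≢b = ⊥-elim (a≢b refl)
≢⇒xor≡true {false} {true}  _   = refl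
≢⇒xor≡true {true}  {false} _   = refl
≢⇒xor≡true {true}  {true}  a≢b = ⊥-elim (a≢b refl)

odd-forwards-suc : ∀ {L} (w : Fin (suc L) → Bool) → odd (forwards w) ≡ w zero xor odd (forwards (w ∘ suc))
odd-forwards-suc w = odd-bit+ (w zero) (forwards (w ∘ suc))

forwards-not+forwards : ∀ {L} (t : Fin L → Bool) → forwards (not ∘ t) + forwards t ≡ L
forwards-not+forwards {zero}  t = refl
forwards-not+forwards {suc L} t with t zero
... | true  = trans (+-suc _ _) (cong suc (forwards-not+forwards (t ∘ suc)))
... | false = cong suc (forwards-not+forwards (t ∘ suc))

forwards-< : ∀ {L} F → F ≤ L → forwards {L} (λ j → toℕ j <ᵇ F) ≡ F
forwards-< {zero}  zero    _         = refl
forwards-< {suc L} zero    _         = forwards-< {L} zero z≤n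
forwards-< {suc L} (suc F) (s≤s F≤L) = cong suc (forwards-< F F≤L)

odd-forwards-xor : ∀ {L} (a b : Fin L → Bool) →
  odd (forwards (λ j → a j xor b j)) ≡ odd (forwards a) xor odd (forwards b)
odd-forwards-xor {zero}  a b = refl
odd-forwards-xor {suc L} a b = begin
  odd (forwards (λ j → a j xor b j))                     ≡⟨ odd-forwards-suc (λ j → a j xor b j) ⟩
  (a zero xor b zero) xor odd (forwards (λ j → a (suc j) xor b (suc j)))
    ≡⟨ cong ((a zero xor b zero) xor_) (odd-forwards-xor (a ∘ suc) (b ∘ suc)) ⟩
  (a zero xor b zero) xor (odd (forwards (a ∘ suc)) xor odd (forwards (b ∘ suc)))
    ≡⟨ interchange (a zero) (b zero) _ _ ⟩
  (a zero xor odd (forwards (a ∘ suc))) xor (b zero xor odd (forwards (b ∘ suc)))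
    ≡⟨ sym (cong₂ _xor_ (odd-forwards-suc a) (odd-forwards-suc b)) ⟩
  odd (forwards a) xor odd (forwards b) ∎
  where open ≡-Reasoning

odd-forwards-telescope : ∀ {L} (s : Fin (suc L) → Bool) →
  odd (forwards (λ j → s (inject₁ j) xor s (suc j))) ≡ s zero xor s (fromℕ L)
odd-forwards-telescope {zero}  s = sym (xor-same (s zero))
odd-forwards-telescope {suc L} s = begin
  odd (forwards (λ j → s (inject₁ j) xor s (suc j)))
    ≡⟨ odd-forwards-suc (λ j → s (inject₁ j) xor s (suc j)) ⟩
  (s zero xor s (suc zero)) xor odd (forwards (λ j → s (suc (inject₁ j)) xor s (suc (suc j))))
    ≡⟨ cong ((s zero xor s (suc zero)) xor_) (odd-forwards-telescope (s ∘ suc)) ⟩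
  (s zero xor s (suc zero)) xor (s (suc zero) xor s (suc (fromℕ L)))
    ≡⟨ xor-assoc (s zero) _ _ ⟩
  s zero xor (s (suc zero) xor (s (suc zero) xor s (suc (fromℕ L))))
    ≡⟨ cong (s zero xor_) (xor-cancelˡ (s (suc zero)) _) ⟩
  s zero xor s (suc (fromℕ L)) ∎
  where open ≡-Reasoning

scan : ∀ {A B : Set} {L} → (A → B → A) → A → (Fin L → B) → Fin (suc L) → A
scan f a w zero = a
scan {L = suc L} f a w (suc i) = scan f (f a (w zero)) (w ∘ suc) i

scan-suc : ∀ {A B : Set} {L} (f : A → B → A) a (w : Fin L → B) j →
  scan f a w (suc j) ≡ f (scan f a w (inject₁ j)) (w j)
scan-suc f a w zero    = refl
scan-suc f a w (suc j) = scan-suc f (f a (w zero)) (w ∘ suc) j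

scan-xor-last : ∀ {L} a (w : Fin L → Bool) → scan _xor_ a w (fromℕ L) ≡ a xor odd (forwards w)
scan-xor-last {zero}  a w = sym (xor-identityʳ a)
scan-xor-last {suc L} a w = begin
  scan _xor_ (a xor w zero) (w ∘ suc) (fromℕ L) ≡⟨ scan-xor-last (a xor w zero) (w ∘ suc) ⟩
  (a xor w zero) xor odd (forwards (w ∘ suc))   ≡⟨ xor-assoc a _ _ ⟩
  a xor (w zero xor odd (forwards (w ∘ suc)))   ≡⟨ cong (a xor_) (sym (odd-forwards-suc w)) ⟩
  a xor odd (forwards w) ∎
  where open ≡-Reasoning

[m%o+n]%o≡[m+n]%o : ∀ m n o .{{_ : NonZero o}} → (m % o + n) % o ≡ (m + n) % o
[m%o+n]%o≡[m+n]%o m n o = begin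
  (m % o + n) % o           ≡⟨ %-distribˡ-+ (m % o) n o ⟩
  (m % o % o + n % o) % o   ≡⟨ cong (λ x → (x + n % o) % o) (m%n%n≡m%n m o) ⟩
  (m % o + n % o) % o       ≡⟨ sym (%-distribˡ-+ m n o) ⟩
  (m + n) % o ∎
  where open ≡-Reasoning

[m+n%o]%o≡[m+n]%o : ∀ m n o .{{_ : NonZero o}} → (m + n % o) % o ≡ (m + n) % o
[m+n%o]%o≡[m+n]%o m n o = begin
  (m + n % o) % o  ≡⟨ %-congˡ (+-comm m (n % o)) ⟩
  (n % o + m) % o  ≡⟨ [m%o+n]%o≡[m+n]%o n m o ⟩
  (n + m) % o      ≡⟨ %-congˡ (+-comm n m) ⟩
  (m + n) % o ∎
  where open ≡-Reasoning

%-cong-+ʳ : ∀ m n p o .{{_ : NonZero o}} → m % o ≡ n % o → (m + p) % o ≡ (n + p) % o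
%-cong-+ʳ m n p o eq = begin
  (m + p) % o      ≡⟨ sym ([m%o+n]%o≡[m+n]%o m p o) ⟩
  (m % o + p) % o  ≡⟨ cong (λ x → (x + p) % o) eq ⟩
  (n % o + p) % o  ≡⟨ [m%o+n]%o≡[m+n]%o n p o ⟩
  (n + p) % o ∎
  where open ≡-Reasoning

[m+n]%o≡m%o⇒o∣n : ∀ m n o .{{_ : NonZero o}} → (m + n) % o ≡ m % o → o ∣ n
[m+n]%o≡m%o⇒o∣n m n o eq = ∣m+n∣m⇒∣n (divides ((m + n) / o) quotients) (n∣m*n (m / o))
  where
  open ≡-Reasoning
  quotients : m / o * o + n ≡ (m + n) / o * o
  quotients = +-cancelˡ-≡ (m % o) _ _ (begin
    m % o + (m / o * o + n)    ≡⟨ sym (+-assoc (m % o) _ n) ⟩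
    m % o + m / o * o + n      ≡⟨ cong (_+ n) (sym (m≡m%n+[m/n]*n m o)) ⟩
    m + n                      ≡⟨ m≡m%n+[m/n]*n (m + n) o ⟩
    (m + n) % o + (m + n) / o * o ≡⟨ cong (_+ (m + n) / o * o) eq ⟩
    m % o + (m + n) / o * o ∎)

-- k + 1 is the inverse of 2 modulo 2k + 1.
odd∣2*⇒∣ : ∀ k n → suc (2 * k) ∣ 2 * n → suc (2 * k) ∣ n
odd∣2*⇒∣ k n m∣2n = ∣m+n∣m⇒∣n (subst (suc (2 * k) ∣_) (expand k n) (∣n⇒∣m*n (suc k) m∣2n)) (n∣m*n n)
  where
  expand : ∀ k n → suc k * (2 * n) ≡ n * suc (2 * k) + n
  expand = solve-∀

∣∧0<∧<2*⇒≡ : ∀ {d n} → d ∣ n → 0 < n → n < 2 * d → n ≡ d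
∣∧0<∧<2*⇒≡ (divides zero refl) () _
∣∧0<∧<2*⇒≡ {d} (divides 1 refl) _ _ = +-identityʳ d
∣∧0<∧<2*⇒≡ {d} (divides (suc (suc q)) refl) _ n<2d =
  ⊥-elim (<⇒≱ n<2d (*-monoˡ-≤ d (m≤m+n 2 q)))

Step : (D : Digraph) → Bool → V D → V D → Set
Step D true  x y = Arc D x y
Step D false x y = Arc D y x

Step-reverse : ∀ {D} b {x y} → Step D b x y → Step D (not b) y x
Step-reverse true  a = a
Step-reverse false a = a

Step-unreverse : ∀ {D} b {x y} → Step D (not b) x y → Step D b y x
Step-unreverse true  a = a
Step-unreverse false a = a

isHom-pushed : ∀ {D H S} {f : V D → V H} →
  IsHom (Pushed D S) H f ⇔ (∀ x y → Arc D x y → Step H (not (S x xor S y)) (f x) (f y))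
isHom-pushed {D} {H} {S} {f} = mk⇔ to from
  where
  to : IsHom (Pushed D S) H f → ∀ x y → Arc D x y → Step H (not (S x xor S y)) (f x) (f y)
  to hom x y a with S x xor S y in sep
  ... | false = hom x y (inj₁ (a , xor≡false⇒≡ sep))
  ... | true  = hom y x (inj₂ (a , ≢-sym (xor≡true⇒≢ sep)))
  from : (∀ x y → Arc D x y → Step H (not (S x xor S y)) (f x) (f y)) → IsHom (Pushed D S) H f
  from steps x y (inj₁ (a , same)) =
    subst (λ b → Step H (not b) (f x) (f y)) (≡⇒xor≡false same) (steps x y a)
  from steps x y (inj₂ (a , differ)) =
    subst (λ b → Step H (not b) (f y) (f x)) (≢⇒xor≡true (≢-sym differ)) (steps y x a)

inner-just : ∀ m (i : Fin (suc m)) {j} → inner m i ≡ just j → inject₁ j ≡ i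
inner-just (suc m) zero    refl = refl
inner-just (suc m) (suc i) eq with inner m i in eq′
inner-just (suc m) (suc i) refl | just j = cong suc (inner-just m i eq′)

inner-nothing : ∀ m (i : Fin (suc m)) → inner m i ≡ nothing → i ≡ fromℕ m
inner-nothing zero    zero    _  = refl
inner-nothing (suc m) (suc i) eq with inner m i in eq′
... | nothing = cong suc (inner-nothing m i eq′)

inner-fromℕ : ∀ m → inner m (fromℕ m) ≡ nothing
inner-fromℕ zero    = refl
inner-fromℕ (suc m) rewrite inner-fromℕ m = refl

module _ {n} {G : SimpleGraph n} {k : ℕ} where

  private
    vertex : Edge G → Fin 2 → Fin (suc (suc (internal k))) → CVert G k
    vertex = pos {G = G} {k = k}

  pos-last : ∀ (e : Edge G) p → vertex e p (fromℕ (suc (internal k))) ≡ inj₁ (proj₁ (proj₂ e))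
  pos-last e p rewrite inner-fromℕ (internal k) = refl

  along-path : ∀ {X : Set} (ℓ : CVert G k → X) (e : Edge G) p (s : Fin (suc (suc (internal k))) → X) →
    ℓ (inj₁ (proj₁ e)) ≡ s zero → ℓ (inj₁ (proj₁ (proj₂ e))) ≡ s (fromℕ (suc (internal k))) →
    (∀ j → ℓ (inj₂ (e , p , j)) ≡ s (suc (inject₁ j))) →
    ∀ i → ℓ (vertex e p i) ≡ s i
  along-path ℓ e p s start end inside zero = start
  along-path ℓ e p s start end inside (suc i) with inner (internal k) i in eq
  ... | just j  = trans (inside j) (cong (s ∘ suc) (inner-just (internal k) i eq))
  ... | nothing = trans end (cong (s ∘ suc) (sym (inner-nothing (internal k) i eq)))

  RespectsPathArcs : (C : Construction G k) (H : Digraph) → (CVert G k → Bool) → (CVert G k → V H) → Set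
  RespectsPathArcs C H S f = ∀ e p j →
    let x = vertex e p (inject₁ j); y = vertex e p (suc j)
    in Step H (orient C e p j xor (S x xor S y)) (f x) (f y)

  isHom-pushed-oriented : ∀ {C : Construction G k} {H S} {f : CVert G k → V H} →
    IsHom (Pushed (Oriented C) S) H f ⇔ RespectsPathArcs C H S f
  isHom-pushed-oriented {C} {H} {S} {f} = mk⇔ to from
    where
    to : IsHom (Pushed (Oriented C) S) H f → RespectsPathArcs C H S f
    to hom e p j with orient C e p j in o
    ... | true  = Equivalence.to isHom-pushed hom _ _ (e , p , j , inj₁ (o , refl , refl))
    ... | false = Step-unreverse (S x xor S y)
        (subst (λ b → Step H (not b) (f y) (f x)) (xor-comm (S y) (S x))
          (Equivalence.to isHom-pushed hom _ _ (e , p , j , inj₂ (o , refl , refl))))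
      where
      x y : CVert G k
      x = vertex e p (inject₁ j)
      y = vertex e p (suc j)
    from : RespectsPathArcs C H S f → IsHom (Pushed (Oriented C) S) H f
    from steps = Equivalence.from isHom-pushed arcSteps
      where
      arcSteps : ∀ x y → CArc C x y → Step H (not (S x xor S y)) (f x) (f y)
      arcSteps _ _ (e , p , j , inj₁ (o , refl , refl)) =
        subst (λ b → Step H (b xor _) _ _) o (steps e p j)
      arcSteps _ _ (e , p , j , inj₂ (o , refl , refl)) =
        subst (λ b → Step H (not b) _ _) (xor-comm (S x) (S y))
          (Step-reverse (S x xor S y) (subst (λ b → Step H (b xor _) _ _) o (steps e p j)))
        where
        x y : CVert G k
        x = vertex e p (inject₁ j)
        y = vertex e p (suc j)

module Cycle (k : ℕ) where

  m : ℕ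
  m = suc (2 * k)

  neighbour : Fin m → Bool → Fin m
  neighbour c true  = fromℕ< (m%n<n (suc (toℕ c)) m)
  neighbour c false = fromℕ< (m%n<n (toℕ c + 2 * k) m)

  Step-neighbour : ∀ b c → Step (DirCycle k) b c (neighbour c b)
  Step-neighbour true  c = toℕ-fromℕ< _
  Step-neighbour false c = begin
    toℕ c                          ≡⟨ sym (m<n⇒m%n≡m (toℕ<n c)) ⟩
    toℕ c % m                      ≡⟨ sym ([m+n]%n≡m%n (toℕ c) m) ⟩
    (toℕ c + m) % m                ≡⟨ %-congˡ (+-suc (toℕ c) (2 * k)) ⟩
    suc (toℕ c + 2 * k) % m        ≡⟨ sym ([m+n%o]%o≡[m+n]%o 1 (toℕ c + 2 * k) m) ⟩
    suc ((toℕ c + 2 * k) % m) % m  ≡⟨ cong (λ x → suc x % m) (sym (toℕ-fromℕ< _)) ⟩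
    suc (toℕ (neighbour c false)) % m ∎
    where open ≡-Reasoning

  trace : ∀ {L} → Fin m → (Fin L → Bool) → Fin (suc L) → Fin m
  trace = scan neighbour

  Step-trace : ∀ {L} c (t : Fin L → Bool) j →
    Step (DirCycle k) (t j) (trace c t (inject₁ j)) (trace c t (suc j))
  Step-trace c t j = subst (Step (DirCycle k) (t j) (trace c t (inject₁ j)))
    (sym (scan-suc neighbour c t j)) (Step-neighbour (t j) (trace c t (inject₁ j)))

  walk : ∀ {L} (g : Fin (suc L) → Fin m) (t : Fin L → Bool) →
    (∀ j → Step (DirCycle k) (t j) (g (inject₁ j)) (g (suc j))) →
    (toℕ (g (fromℕ L)) + forwards (not ∘ t)) % m ≡ (toℕ (g zero) + forwards t) % m
  walk {zero}  g t steps = refl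
  walk {suc L} g t steps with t zero | steps zero | walk (g ∘ suc) (t ∘ suc) (steps ∘ suc)
  ... | true | arc | rest = begin
    (x + B) % m                  ≡⟨ rest ⟩
    (toℕ (g (suc zero)) + F) % m ≡⟨ cong (λ y → (y + F) % m) arc ⟩
    (suc a % m + F) % m          ≡⟨ [m%o+n]%o≡[m+n]%o (suc a) F m ⟩
    (suc a + F) % m              ≡⟨ %-congˡ (sym (+-suc a F)) ⟩
    (a + suc F) % m ∎
    where
    open ≡-Reasoning
    a x F B : ℕ
    a = toℕ (g zero)
    x = toℕ (g (fromℕ (suc L)))
    F = forwards (t ∘ suc)
    B = forwards (not ∘ t ∘ suc)
  ... | false | arc | rest = begin
    (x + suc B) % m              ≡⟨ %-congˡ (+-suc x B) ⟩
    suc (x + B) % m              ≡⟨ sym ([m+n%o]%o≡[m+n]%o 1 (x + B) m) ⟩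
    suc ((x + B) % m) % m        ≡⟨ cong (λ y → suc y % m) rest ⟩
    suc ((b + F) % m) % m        ≡⟨ [m+n%o]%o≡[m+n]%o 1 (b + F) m ⟩
    (suc b + F) % m              ≡⟨ sym ([m%o+n]%o≡[m+n]%o (suc b) F m) ⟩
    (suc b % m + F) % m          ≡⟨ cong (λ y → (y + F) % m) (sym arc) ⟩
    (toℕ (g zero) + F) % m ∎
    where
    open ≡-Reasoning
    b x F B : ℕ
    b = toℕ (g (suc zero))
    x = toℕ (g (fromℕ (suc L)))
    F = forwards (t ∘ suc)
    B = forwards (not ∘ t ∘ suc)

  -- The end of a walk of length 4k from a with F forward steps: a + F − (4k − F) ≡ a + 2 + 2F,
  -- since −4k ≡ 2 (mod m).
  endpoint : ℕ → ℕ → ℕ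
  endpoint a F = (a + 2 + 2 * F) % m

  walk-endpoint : ∀ x a B F → (x + B) % m ≡ (a + F) % m → B + F ≡ 4 * k → x % m ≡ endpoint a F
  walk-endpoint x a B F walked B+F≡4k = begin
    x % m                       ≡⟨ sym ([m+kn]%n≡m%n x 2 m) ⟩
    (x + 2 * m) % m             ≡⟨ %-congˡ (trans (regroup x k) (cong (λ y → x + (y + 2)) (sym B+F≡4k))) ⟩
    (x + (B + F + 2)) % m       ≡⟨ %-congˡ (regroup′ x B F) ⟩
    (x + B + (F + 2)) % m       ≡⟨ %-cong-+ʳ (x + B) (a + F) (F + 2) m walked ⟩
    (a + F + (F + 2)) % m       ≡⟨ %-congˡ (collect a F) ⟩
    (a + 2 + 2 * F) % m ∎
    where
    open ≡-Reasoning
    regroup : ∀ x k → x + 2 * suc (2 * k) ≡ x + (4 * k + 2)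
    regroup = solve-∀
    regroup′ : ∀ x B F → x + (B + F + 2) ≡ x + B + (F + 2)
    regroup′ = solve-∀
    collect : ∀ a F → a + F + (F + 2) ≡ a + 2 + 2 * F
    collect = solve-∀

  endpoint-2k : ∀ a → endpoint a (2 * k) ≡ a % m
  endpoint-2k a = trans (%-congˡ (regroup a k)) ([m+kn]%n≡m%n a 2 m)
    where
    regroup : ∀ a k → a + 2 + 2 * (2 * k) ≡ a + 2 * suc (2 * k)
    regroup = solve-∀

  endpoint-closed : ∀ a F → endpoint a F ≡ a % m → F ≤ 4 * k → F ≡ 2 * k
  endpoint-closed a F closed F≤4k = suc-injective (∣∧0<∧<2*⇒≡ m∣1+F (s≤s z≤n) 1+F<2m)
    where
    regroup : ∀ a F → a + 2 + 2 * F ≡ a + 2 * suc F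
    regroup = solve-∀
    double : ∀ k → 2 * suc (2 * k) ≡ suc (suc (4 * k))
    double = solve-∀
    m∣1+F : m ∣ suc F
    m∣1+F = odd∣2*⇒∣ k (suc F) ([m+n]%o≡m%o⇒o∣n a (2 * suc F) m (trans (%-congˡ (sym (regroup a F))) closed))
    1+F<2m : suc F < 2 * m
    1+F<2m = ≤-trans (s≤s (s≤s F≤4k)) (≤-reflexive (sym (double k)))

  endpoint-surjective : ∀ a b → a < m → b < m → a ≢ b → Σ ℕ λ F → F < 2 * k × endpoint a F ≡ b
  endpoint-surjective a b a<m b<m a≢b = F , F<2k , reaches
    where
    open ≡-Reasoning
    -- 2F ≡ b − a − 2 (mod m), solved by multiplying with k + 1, the inverse of 2.
    d F q : ℕ
    d = b + (2 * k ∸ a) + 2 * k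
    F = d * suc k % m
    q = d * suc k / m
    expand : ∀ a b X k → a + 2 + 2 * ((b + X + 2 * k) * suc k)
                       ≡ (a + X) + (2 + b + 2 * k) + (b + X + 2 * k) * suc (2 * k)
    expand = solve-∀
    collect : ∀ b X k → 2 * k + (2 + b + 2 * k) + (b + X + 2 * k) * suc (2 * k)
                      ≡ b + (2 + (b + X + 2 * k)) * suc (2 * k)
    collect = solve-∀
    distrib : ∀ a F q k → a + 2 + 2 * F + 2 * q * suc (2 * k) ≡ a + 2 + 2 * (F + q * suc (2 * k))
    distrib = solve-∀
    shifted : a + 2 + 2 * F + 2 * q * m ≡ b + (2 + d) * m
    shifted = begin
      a + 2 + 2 * F + 2 * q * m           ≡⟨ distrib a F q k ⟩
      a + 2 + 2 * (F + q * m)             ≡⟨ cong (λ y → a + 2 + 2 * y) (sym (m≡m%n+[m/n]*n (d * suc k) m)) ⟩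
      a + 2 + 2 * (d * suc k)             ≡⟨ expand a b (2 * k ∸ a) k ⟩
      (a + (2 * k ∸ a)) + (2 + b + 2 * k) + d * m
        ≡⟨ cong (λ y → y + (2 + b + 2 * k) + d * m) (m+[n∸m]≡n (≤-pred a<m)) ⟩
      2 * k + (2 + b + 2 * k) + d * m     ≡⟨ collect b (2 * k ∸ a) k ⟩
      b + (2 + d) * m ∎
    reaches : endpoint a F ≡ b
    reaches = begin
      (a + 2 + 2 * F) % m                 ≡⟨ sym ([m+kn]%n≡m%n (a + 2 + 2 * F) (2 * q) m) ⟩
      (a + 2 + 2 * F + 2 * q * m) % m     ≡⟨ %-congˡ shifted ⟩
      (b + (2 + d) * m) % m               ≡⟨ [m+kn]%n≡m%n b (2 + d) m ⟩
      b % m                               ≡⟨ m<n⇒m%n≡m b<m ⟩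
      b ∎
    F≢2k : F ≢ 2 * k
    F≢2k F≡2k = a≢b (begin
      a                   ≡⟨ sym (m<n⇒m%n≡m a<m) ⟩
      a % m               ≡⟨ sym (endpoint-2k a) ⟩
      endpoint a (2 * k)  ≡⟨ cong (endpoint a) (sym F≡2k) ⟩
      endpoint a F        ≡⟨ reaches ⟩
      b ∎)
    F<2k : F < 2 * k
    F<2k = ≤∧≢⇒< (≤-pred (m%n<n (d * suc k) m)) F≢2k

  <2k⇒+m≤4k : ∀ {F} → F < 2 * k → F + m ≤ 4 * k
  <2k⇒+m≤4k {F} F<2k = begin
    F + suc (2 * k)  ≡⟨ +-suc F (2 * k) ⟩
    suc F + 2 * k    ≤⟨ +-monoˡ-≤ (2 * k) F<2k ⟩
    2 * k + 2 * k    ≡⟨ double k ⟩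
    4 * k ∎
    where
    open ≤-Reasoning
    double : ∀ k → 2 * k + 2 * k ≡ 4 * k
    double = solve-∀

  -- Adding m to the number of forward steps flips its parity and keeps the endpoint.
  endpoint-surjective-parity : ∀ a b → a < m → b < m → a ≢ b → ∀ π →
    Σ ℕ λ F → F ≤ 4 * k × odd F ≡ π × endpoint a F ≡ b
  endpoint-surjective-parity a b a<m b<m a≢b π with endpoint-surjective a b a<m b<m a≢b
  ... | F , F<2k , reaches with odd F ≟ᵇ π
  ...   | yes oddF≡π = F , ≤-trans (m≤m+n F m) (<2k⇒+m≤4k F<2k) , oddF≡π , reaches
  ...   | no oddF≢π = F + m , <2k⇒+m≤4k F<2k , parity , reaches′
    where
    open ≡-Reasoning
    parity : odd (F + m) ≡ π
    parity = begin
      odd (F + m)                 ≡⟨ odd-+ F m ⟩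
      odd F xor not (odd (2 * k)) ≡⟨ cong (λ y → odd F xor not y) (odd-2* k) ⟩
      odd F xor true              ≡⟨ xor-comm (odd F) true ⟩
      not (odd F)                 ≡⟨ sym (¬-not (oddF≢π ∘ sym)) ⟩
      π ∎
    regroup : ∀ a F k → a + 2 + 2 * (F + suc (2 * k)) ≡ a + 2 + 2 * F + 2 * suc (2 * k)
    regroup = solve-∀
    reaches′ : endpoint a (F + m) ≡ b
    reaches′ = trans (%-congˡ (regroup a F k)) (trans ([m+kn]%n≡m%n (a + 2 + 2 * F) 2 m) reaches)

module FromColoring {n} {G : SimpleGraph n} {k′} (C : Construction G (suc k′))
  (col : Fin n → Fin (suc (2 * suc k′))) (proper : ∀ u v → adj G u v ≡ true → col u ≢ col v) where

  k : ℕ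
  k = suc k′
  open Cycle k

  private
    L : ℕ
    L = suc (internal k)
    vertex : Edge G → Fin 2 → Fin (suc L) → CVert G k
    vertex = pos {G = G} {k = k}

  -- The walk along each path takes F forward and then 4k − F backward steps; F has the
  -- parity of the forward arcs, so that the push labels return to false at the end.
  forwardSteps : ∀ e p → Σ ℕ λ F → F ≤ 4 * k × odd F ≡ odd (forwards (orient C e p))
                                   × endpoint (toℕ (col (proj₁ e))) F ≡ toℕ (col (proj₁ (proj₂ e)))
  forwardSteps e@(u , v , _ , uv) p = endpoint-surjective-parity (toℕ (col u)) (toℕ (col v))
    (toℕ<n (col u)) (toℕ<n (col v)) (proper u v uv ∘ toℕ-injective) (odd (forwards (orient C e p)))

  forwardCount : Edge G → Fin 2 → ℕ
  forwardCount e p = proj₁ (forwardSteps e p)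

  direction : Edge G → Fin 2 → Fin L → Bool
  direction e p j = toℕ j <ᵇ forwardCount e p

  colorAlong : Edge G → Fin 2 → Fin (suc L) → Fin m
  colorAlong e p = trace (col (proj₁ e)) (direction e p)

  pushedAlong : Edge G → Fin 2 → Fin (suc L) → Bool
  pushedAlong e p = scan _xor_ false (λ j → orient C e p j xor direction e p j)

  pushSet : CVert G k → Bool
  pushSet (inj₁ _)           = false
  pushSet (inj₂ (e , p , j)) = pushedAlong e p (suc (inject₁ j))

  coloring : CVert G k → Fin m
  coloring (inj₁ u)           = col u
  coloring (inj₂ (e , p , j)) = colorAlong e p (suc (inject₁ j))

  forwards-direction : ∀ e p → forwards (direction e p) ≡ forwardCount e p
  forwards-direction e p = forwards-< (forwardCount e p) (proj₁ (proj₂ (forwardSteps e p)))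

  colorAlong-last : ∀ e p → colorAlong e p (fromℕ L) ≡ col (proj₁ (proj₂ e))
  colorAlong-last e p = toℕ-injective (begin
    toℕ (colorAlong e p (fromℕ L))       ≡⟨ sym (m<n⇒m%n≡m (toℕ<n (colorAlong e p (fromℕ L)))) ⟩
    toℕ (colorAlong e p (fromℕ L)) % m   ≡⟨ walk-endpoint x a B F walked B+F≡4k ⟩
    endpoint a F                          ≡⟨ proj₂ (proj₂ (proj₂ (forwardSteps e p))) ⟩
    toℕ (col (proj₁ (proj₂ e))) ∎)
    where
    open ≡-Reasoning
    x a B F : ℕ
    x = toℕ (colorAlong e p (fromℕ L))
    a = toℕ (col (proj₁ e))
    B = forwards (not ∘ direction e p)
    F = forwardCount e p
    B+F≡4k : B + F ≡ 4 * k
    B+F≡4k = trans (cong (B +_) (sym (forwards-direction e p))) (forwards-not+forwards (direction e p))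
    walked : (x + B) % m ≡ (a + F) % m
    walked = subst (λ y → (x + B) % m ≡ (a + y) % m) (forwards-direction e p)
      (walk (colorAlong e p) (direction e p) (Step-trace (col (proj₁ e)) (direction e p)))

  pushedAlong-last : ∀ e p → pushedAlong e p (fromℕ L) ≡ false
  pushedAlong-last e p = begin
    pushedAlong e p (fromℕ L)                  ≡⟨ scan-xor-last false (λ j → o j xor direction e p j) ⟩
    odd (forwards (λ j → o j xor direction e p j)) ≡⟨ odd-forwards-xor o (direction e p) ⟩
    odd (forwards o) xor odd (forwards (direction e p))
      ≡⟨ cong (λ y → odd (forwards o) xor odd y) (forwards-direction e p) ⟩
    odd (forwards o) xor odd (forwardCount e p) ≡⟨ cong (odd (forwards o) xor_) (proj₁ (proj₂ (proj₂ (forwardSteps e p)))) ⟩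
    odd (forwards o) xor odd (forwards o)      ≡⟨ xor-same (odd (forwards o)) ⟩
    false ∎
    where
    open ≡-Reasoning
    o : Fin L → Bool
    o = orient C e p

  pushSet-along : ∀ e p i → pushSet (vertex e p i) ≡ pushedAlong e p i
  pushSet-along e p = along-path {k = k} pushSet e p (pushedAlong e p) refl (sym (pushedAlong-last e p)) (λ _ → refl)

  coloring-along : ∀ e p i → coloring (vertex e p i) ≡ colorAlong e p i
  coloring-along e p = along-path {k = k} coloring e p (colorAlong e p) refl (sym (colorAlong-last e p)) (λ _ → refl)

  respects : RespectsPathArcs C (DirCycle k) pushSet coloring
  respects e p j = subst₂ (Step (DirCycle k) (o xor (pushSet x xor pushSet y)))
    (sym (coloring-along e p (inject₁ j))) (sym (coloring-along e p (suc j)))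
    (subst (λ b → Step (DirCycle k) b (colorAlong e p (inject₁ j)) (colorAlong e p (suc j)))
      (sym effective) (Step-trace (col (proj₁ e)) (direction e p) j))
    where
    open ≡-Reasoning
    x y : CVert G k
    x = vertex e p (inject₁ j)
    y = vertex e p (suc j)
    o s t : Bool
    o = orient C e p j
    s = pushedAlong e p (inject₁ j)
    t = direction e p j
    effective : o xor (pushSet x xor pushSet y) ≡ t
    effective = begin
      o xor (pushSet x xor pushSet y)
        ≡⟨ cong₂ (λ a b → o xor (a xor b)) (pushSet-along e p (inject₁ j)) (pushSet-along e p (suc j)) ⟩
      o xor (s xor pushedAlong e p (suc j))
        ≡⟨ cong (λ b → o xor (s xor b)) (scan-suc _xor_ false (λ i → orient C e p i xor direction e p i) j) ⟩
      o xor (s xor (s xor (o xor t)))  ≡⟨ cong (o xor_) (xor-cancelˡ s (o xor t)) ⟩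
      o xor (o xor t)                  ≡⟨ xor-cancelˡ o t ⟩
      t ∎

  pushableHom : PushableHom (Oriented C) (DirCycle k)
  pushableHom = pushSet , coloring , Equivalence.from (isHom-pushed-oriented {C = C}) respects

module FromPushableHom {n} {G : SimpleGraph n} {k′} (C : Construction G (suc k′))
  (S : CVert G (suc k′) → Bool) (f : CVert G (suc k′) → Fin (suc (2 * suc k′)))
  (hom : IsHom (Pushed (Oriented C) S) (DirCycle (suc k′)) f) where

  k : ℕ
  k = suc k′
  open Cycle k

  private
    L : ℕ
    L = suc (internal k)
    vertex : Edge G → Fin 2 → Fin (suc L) → CVert G k
    vertex = pos {G = G} {k = k}

  -- A closed walk of length 4k in the (2k+1)-cycle has exactly 2k forward steps.
  path-parity : ∀ e p → f (inj₁ (proj₁ e)) ≡ f (inj₁ (proj₁ (proj₂ e))) →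
    odd (forwards (orient C e p)) ≡ S (inj₁ (proj₁ e)) xor S (inj₁ (proj₁ (proj₂ e)))
  path-parity e p same = xor≡false⇒≡ (begin
    odd (forwards o) xor (s zero xor S (inj₁ (proj₁ (proj₂ e))))
      ≡⟨ cong (λ x → odd (forwards o) xor (s zero xor S x)) (sym (pos-last {G = G} {k = k} e p)) ⟩
    odd (forwards o) xor (s zero xor s (fromℕ L))  ≡⟨ cong (odd (forwards o) xor_) (sym (odd-forwards-telescope s)) ⟩
    odd (forwards o) xor odd (forwards δ)          ≡⟨ sym (odd-forwards-xor o δ) ⟩
    odd (forwards t)                               ≡⟨ cong odd balanced ⟩
    odd (2 * k)                                    ≡⟨ odd-2* k ⟩
    false ∎)
    where
    open ≡-Reasoning
    o : Fin L → Bool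
    o = orient C e p
    s : Fin (suc L) → Bool
    s i = S (vertex e p i)
    δ t : Fin L → Bool
    δ j = s (inject₁ j) xor s (suc j)
    t j = o j xor δ j
    g : Fin (suc L) → Fin m
    g i = f (vertex e p i)
    a B F : ℕ
    a = toℕ (g zero)
    B = forwards (not ∘ t)
    F = forwards t
    closed : g (fromℕ L) ≡ g zero
    closed = trans (cong f (pos-last {G = G} {k = k} e p)) (sym same)
    walked : (a + B) % m ≡ (a + F) % m
    walked = subst (λ x → (toℕ x + B) % m ≡ (a + F) % m) closed
      (walk g t (Equivalence.to (isHom-pushed-oriented {C = C}) hom e p))
    balanced : F ≡ 2 * k
    balanced = endpoint-closed a F
      (sym (walk-endpoint a a B F walked (forwards-not+forwards t)))
      (≤-trans (m≤n+m F B) (≤-reflexive (forwards-not+forwards t)))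

  edge-colors-differ : ∀ e → f (inj₁ (proj₁ e)) ≢ f (inj₁ (proj₁ (proj₂ e)))
  edge-colors-differ e same = false≢true (begin
    false                                    ≡⟨ sym (odd-even (forwards (orient C e zero)) (evenP C e)) ⟩
    odd (forwards (orient C e zero))         ≡⟨ path-parity e zero same ⟩
    S (inj₁ (proj₁ e)) xor S (inj₁ (proj₁ (proj₂ e))) ≡⟨ sym (path-parity e (suc zero) same) ⟩
    odd (forwards (orient C e (suc zero)))   ≡⟨ odd-odd (forwards (orient C e (suc zero))) (oddP C e) ⟩
    true ∎)
    where
    open ≡-Reasoning
    false≢true : false ≢ true
    false≢true ()

  colorable : Colorable G m
  colorable = (λ u → f (inj₁ u)) , proper
    where
    proper : ∀ u v → adj G u v ≡ true → f (inj₁ u) ≢ f (inj₁ v)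
    proper u v uv with <-cmpᶠ u v
    ... | tri< u<v _ _ = edge-colors-differ (u , v , u<v , uv)
    ... | tri≈ _ refl _ = λ _ → true≢false (trans (sym uv) (irref G u))
      where true≢false : true ≢ false
            true≢false ()
    ... | tri> _ _ v<u = edge-colors-differ (v , u , v<u , trans (SimpleGraph.sym G v u) uv) ∘ sym

mainTheorem5 : (k : ℕ) → 1 ≤ k → (n : ℕ) → (G : SimpleGraph n) →
    (C : Construction G k) →
    Colorable G (suc (2 * k)) ⇔ PushableHom (Oriented C) (DirCycle k)
mainTheorem5 (suc k′) _ _ _ C = mk⇔
  (λ (col , proper) → FromColoring.pushableHom C col proper)
  (λ (S , f , hom) → FromPushableHom.colorable C S f hom)
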